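{- Let $a,b,c,d$ be positive integers with $b\ge 2a$, $c>b$ and $d>c+b$. Then Left strongly dominates the game $(\{a,b\},\{c,d\})$; more precisely its outcome sequence is $\mathcal P^a\mathcal L^{c-a}\mathcal N^a\mathcal L^{d-c-a}\mathcal N^a\mathcal L^\infty$, i.e. $o(n)=\mathcal P$ for $0\le n<a$, $\mathcal L$ for $a\le n<c$, $\mathcal N$ for $c\le n<c+a$, $\mathcal L$ for $c+a\le n<d$, $\mathcal N$ for $d\le n<d+a$, and $\mathcal L$ for all $n\ge d+a$.
   Context: A partizan subtraction game $(S_L,S_R)$, with $S_L,S_R$ finite sets of positive integers, is played on a heap of $n$ tokens. Two players, Left and Right, alternate moves; Left removes $s\in S_L$ tokens and Right removes $s\in S_R$ tokens (at most the current heap size). A player unable to move loses. The outcome $o(n)$ is $\mathcal L$ (Left wins whoever starts), $\mathcal R$ (Right wins whoever starts), $\mathcal N$ (first player wins) or $\mathcal P$ (second player wins). -}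

module Defs where

open import Data.Nat using (ℕ; zero; suc; _∸_; _≤ᵇ_; _+_; _≤_; _<_)
open import Data.Bool using (Bool; true; false; not; _∧_; _∨_)
open import Data.List using (List)
open import Data.Bool.ListAction using (any)

-- A partizan subtraction game (S_L , S_R): Left may remove s ∈ S_L tokens,
-- Right may remove s ∈ S_R tokens (s ≤ heap size).  Normal play.

-- Whether the player to move (Left resp. Right) wins from heap n,
-- computed with fuel; the fuel (suc n) suffices since all moves remove ≥ 1
-- token.
mutual
  leftWinsFuel : ℕ → List ℕ → List ℕ → ℕ → Bool
  leftWinsFuel zero    SL SR n = false
  leftWinsFuel (suc k) SL SR n =
    any (λ s → (s ≤ᵇ n) ∧ not (rightWinsFuel k SL SR (n ∸ s))) SL

  rightWinsFuel : ℕ → List ℕ → List ℕ → ℕ → Bool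
  rightWinsFuel zero    SL SR n = false
  rightWinsFuel (suc k) SL SR n =
    any (λ s → (s ≤ᵇ n) ∧ not (leftWinsFuel k SL SR (n ∸ s))) SR

leftWinsFirst : List ℕ → List ℕ → ℕ → Bool
leftWinsFirst SL SR n = leftWinsFuel (suc n) SL SR n

rightWinsFirst : List ℕ → List ℕ → ℕ → Bool
rightWinsFirst SL SR n = rightWinsFuel (suc n) SL SR n

data Outcome : Set where
  𝓛 𝓡 𝓝 𝓟 : Outcome

outcomeOf : Bool → Bool → Outcome
outcomeOf true  false = 𝓛
outcomeOf false true  = 𝓡
outcomeOf true  true  = 𝓝
outcomeOf false false = 𝓟

outcome : List ℕ → List ℕ → ℕ → Outcome
outcome SL SR n = outcomeOf (leftWinsFirst SL SR n) (rightWinsFirst SL SR n)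

-- Left, moving first, wins exactly when n ≥ a; Right, moving first, wins exactly when
-- n lies in one of the windows [c , c + a⟩ and [d , d + a⟩, i.e. when one move leaves
-- Left fewer than a tokens. Both predicates satisfy the one-step recursion of the game,
-- and since every move shrinks the heap that recursion has only one solution. The Right
-- equation is immediate; for the Left one, if Left's a-move lands in a window of Right
-- then, as b ≥ 2a, the b-move lands below that window, and as d > c + b, the b-move from
-- a heap just above the d-window still lands above the c-window.
module Submission where

open import Defs
open import Data.Nat using (ℕ; suc; _+_; _*_; _∸_; _≤_; _<_; _≤ᵇ_; _≤?_; s≤s)
open import Data.Nat.Properties
open import Data.Bool using (Bool; true; false; not; _∧_; _∨_; T)
open import Data.Bool.ListAction using (any)
open import Data.List using (List; []; _∷_)
open import Data.List.Relation.Unary.All using (All; []; _∷_)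
open import Data.List.Relation.Unary.Any as Any using (Any; here; there; any?)
open import Data.Product using (_×_; _,_; proj₁; proj₂)
open import Data.Sum using (_⊎_; inj₁; inj₂)
open import Function using (_∘_)
open import Relation.Nullary using (¬_; Dec; yes; no; does; map′; _×-dec_; ¬?; T?; ofʸ)
open import Relation.Nullary.Decidable using (dec-true; dec-false; does-≡; isYes≗does; toWitness)
open import Relation.Binary.PropositionalEquality
  using (_≡_; refl; sym; trans; cong; cong₂; subst)
open import Algebra.Properties.CommutativeSemigroup +-commutativeSemigroup using (xy∙z≈xz∙y)

canWin : List ℕ → (ℕ → Bool) → ℕ → Bool
canWin S opponentWins n = any (λ s → (s ≤ᵇ n) ∧ not (opponentWins (n ∸ s))) S

canWin-cong : ∀ {S f g n} → All (0 <_) S → (∀ m → m < n → f m ≡ g m) →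
              canWin S f n ≡ canWin S g n
canWin-cong [] _ = refl
canWin-cong {s ∷ _} {f} {g} {n} (s>0 ∷ S>0) f≗g = cong₂ _∨_ move (canWin-cong S>0 f≗g)
  where
  move : (s ≤ᵇ n) ∧ not (f (n ∸ s)) ≡ (s ≤ᵇ n) ∧ not (g (n ∸ s))
  move with s ≤ᵇ n | ≤ᵇ-reflects-≤ s n
  ... | false | _        = refl
  ... | true  | ofʸ s≤n = cong not (f≗g (n ∸ s) (∸-monoʳ-< s>0 s≤n))

module _ {SL SR : List ℕ} (SL>0 : All (0 <_) SL) (SR>0 : All (0 <_) SR)
         {leftWins rightWins : ℕ → Bool}
         (leftWins-eq : ∀ n → leftWins n ≡ canWin SL rightWins n)
         (rightWins-eq : ∀ n → rightWins n ≡ canWin SR leftWins n) where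

  winsFuel≡solution : ∀ k n → n < k →
    leftWinsFuel k SL SR n ≡ leftWins n × rightWinsFuel k SL SR n ≡ rightWins n
  winsFuel≡solution (suc k) n (s≤s n≤k) =
    trans (canWin-cong SL>0 (λ m → proj₂ ∘ below m)) (sym (leftWins-eq n)) ,
    trans (canWin-cong SR>0 (λ m → proj₁ ∘ below m)) (sym (rightWins-eq n))
    where
    below : ∀ m → m < n →
      leftWinsFuel k SL SR m ≡ leftWins m × rightWinsFuel k SL SR m ≡ rightWins m
    below m m<n = winsFuel≡solution k m (<-≤-trans m<n n≤k)

  outcome≡solution : ∀ n → outcome SL SR n ≡ outcomeOf (leftWins n) (rightWins n)
  outcome≡solution n =
    let left≡ , right≡ = winsFuel≡solution (suc n) n ≤-refl in cong₂ outcomeOf left≡ right≡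

WinningMove : (ℕ → Bool) → ℕ → ℕ → Set
WinningMove opponentWins n s = s ≤ n × ¬ T (opponentWins (n ∸ s))

winningMove? : ∀ opponentWins n s → Dec (WinningMove opponentWins n s)
winningMove? opponentWins n s = (s ≤? n) ×-dec ¬? (T? (opponentWins (n ∸ s)))

canWin≡does-any? : ∀ S opponentWins n →
                   canWin S opponentWins n ≡ does (any? (winningMove? opponentWins n) S)
canWin≡does-any? []      _            _ = refl
canWin≡does-any? (s ∷ S) opponentWins n =
  cong ((s ≤ᵇ n) ∧ not (opponentWins (n ∸ s)) ∨_) (canWin≡does-any? S opponentWins n)

infix 4 _∈[_,_⟩
_∈[_,_⟩ : ℕ → ℕ → ℕ → Set
n ∈[ l , u ⟩ = l ≤ n × n < u

m<n+o⇒m∸o<n : ∀ {m n o} → o ≤ m → m < n + o → m ∸ o < n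
m<n+o⇒m∸o<n {m} {n} {o} o≤m m<n+o = subst (m ∸ o <_) (m+n∸n≡m n o) (∸-monoˡ-< m<n+o o≤m)

∸-∈[⟩ : ∀ {a n l u} → a ≤ n → n ∸ a ∈[ l , u ⟩ → n ∈[ l + a , u + a ⟩
∸-∈[⟩ {a} a≤n (l≤n∸a , n∸a<u) =
  m≤o∸n⇒m+n≤o _ a≤n l≤n∸a , subst (_< _) (m∸n+n≡m a≤n) (+-monoˡ-< a n∸a<u)

thresholdMove⇒window : ∀ {a n s} → WinningMove (a ≤ᵇ_) n s → n ∈[ s , s + a ⟩
thresholdMove⇒window {a} {n} {s} (s≤n , n∸s≱a) =
  s≤n , subst (_< s + a) (m+[n∸m]≡n s≤n) (+-monoʳ-< s (≰⇒> (n∸s≱a ∘ ≤⇒≤ᵇ)))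

window⇒thresholdMove : ∀ {a n s} → n ∈[ s , s + a ⟩ → WinningMove (a ≤ᵇ_) n s
window⇒thresholdMove {a} {n} {s} (s≤n , n<s+a) = s≤n , λ a≤n∸s →
  <⇒≱ n<s+a (subst (_≤ n) (+-comm a s) (m≤o∸n⇒m+n≤o a s≤n (≤ᵇ⇒≤ a (n ∸ s) a≤n∸s)))

outsideWindow : ∀ {a m s} → m < s ⊎ s + a ≤ m → ¬ m ∈[ s , s + a ⟩
outsideWindow (inj₁ m<s)   (s≤m , _)     = <⇒≱ m<s s≤m
outsideWindow (inj₂ s+a≤m) (_ , m<s+a) = <⇒≱ m<s+a s+a≤m

module Game (a b c d : ℕ) (a>0 : 0 < a) (b>0 : 0 < b) (c>0 : 0 < c) (d>0 : 0 < d)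
            (2a≤b : 2 * a ≤ b) (b<c : b < c) (c+b<d : c + b < d) where

  SL SR : List ℕ
  SL = a ∷ b ∷ []
  SR = c ∷ d ∷ []

  a+a≤b : a + a ≤ b
  a+a≤b = subst (_≤ b) (cong (a +_) (+-identityʳ a)) 2a≤b

  a≤b : a ≤ b
  a≤b = ≤-trans (m≤m+n a a) a+a≤b

  a<c : a < c
  a<c = ≤-<-trans a≤b b<c

  c<d : c < d
  c<d = ≤-<-trans (m≤m+n c b) c+b<d

  a<d : a < d
  a<d = <-trans a<c c<d

  b<d : b < d
  b<d = <-trans b<c c<d

  RightWindow : ℕ → Set
  RightWindow n = Any (λ s → n ∈[ s , s + a ⟩) SR

  rightWindow? : ∀ n → Dec (RightWindow n)
  rightWindow? n = map′ (Any.map thresholdMove⇒window) (Any.map window⇒thresholdMove)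
                        (any? (winningMove? (a ≤ᵇ_) n) SR)

  rightWins : ℕ → Bool
  rightWins n = does (rightWindow? n)

  rightWins-sound : ∀ {n} → T (rightWins n) → RightWindow n
  rightWins-sound {n} = toWitness ∘ subst T (sym (isYes≗does (rightWindow? n)))

  outsideRightWindow : ∀ {m} → m < c ⊎ c + a ≤ m → m < d ⊎ d + a ≤ m → ¬ RightWindow m
  outsideRightWindow out-c _     (here w)          = outsideWindow out-c w
  outsideRightWindow _     out-d (there (here w))  = outsideWindow out-d w
  outsideRightWindow _     _     (there (there ()))

  bMoveBelow : ∀ {n s} → b ≤ s → n ∈[ s + a , s + a + a ⟩ → b ≤ n × n ∸ b < s
  bMoveBelow {n} {s} b≤s (s+a≤n , n<s+a+a) =
    b≤n , m<n+o⇒m∸o<n b≤n (<-≤-trans n<s+a+a s+a+a≤s+b)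
    where
    b≤n : b ≤ n
    b≤n = ≤-trans b≤s (≤-trans (m≤m+n s a) s+a≤n)
    s+a+a≤s+b : s + a + a ≤ s + b
    s+a+a≤s+b = subst (_≤ s + b) (sym (+-assoc s a a)) (+-monoʳ-≤ s a+a≤b)

  bMoveEscapes : ∀ {n} → a ≤ n → RightWindow (n ∸ a) → b ≤ n × ¬ RightWindow (n ∸ b)
  bMoveEscapes a≤n (here w) =
    let b≤n , n∸b<c = bMoveBelow (<⇒≤ b<c) (∸-∈[⟩ a≤n w)
    in  b≤n , outsideRightWindow (inj₁ n∸b<c) (inj₁ (<-trans n∸b<c c<d))
  bMoveEscapes {n} a≤n (there (here w)) =
    let landing@(d+a≤n , _) = ∸-∈[⟩ a≤n w
        b≤n , n∸b<d         = bMoveBelow (<⇒≤ b<d) landing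
        c+a+b≤n             = subst (_≤ n) (xy∙z≈xz∙y c b a) (≤-trans (<⇒≤ (+-monoˡ-< a c+b<d)) d+a≤n)
    in  b≤n , outsideRightWindow (inj₂ (m+n≤o⇒m≤o∸n (c + a) c+a+b≤n)) (inj₁ n∸b<d)
  bMoveEscapes _ (there (there ()))

  leftWinningMove : ∀ {n} → a ≤ n → Any (WinningMove rightWins n) SL
  leftWinningMove {n} a≤n with T? (rightWins (n ∸ a))
  ... | no  rightLoses = here (a≤n , rightLoses)
  ... | yes rightWinsAfterA =
    let b≤n , escapes = bMoveEscapes a≤n (rightWins-sound rightWinsAfterA)
    in  there (here (b≤n , escapes ∘ rightWins-sound))

  leftMoveLegal : ∀ {n} → Any (WinningMove rightWins n) SL → a ≤ n
  leftMoveLegal (here (a≤n , _))         = a≤n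
  leftMoveLegal (there (here (b≤n , _))) = ≤-trans a≤b b≤n
  leftMoveLegal (there (there ()))

  leftWins-eq : ∀ n → (a ≤ᵇ n) ≡ canWin SL rightWins n
  leftWins-eq n = trans
    (does-≡ (map′ leftWinningMove leftMoveLegal (a ≤? n)) (any? (winningMove? rightWins n) SL))
    (sym (canWin≡does-any? SL rightWins n))

  rightWins-eq : ∀ n → rightWins n ≡ canWin SR (a ≤ᵇ_) n
  rightWins-eq n = sym (canWin≡does-any? SR (a ≤ᵇ_) n)

  outcome≡ : ∀ {n l r} → (a ≤ᵇ n) ≡ l → rightWins n ≡ r → outcome SL SR n ≡ outcomeOf l r
  outcome≡ {n} l≡ r≡ = trans
    (outcome≡solution (a>0 ∷ b>0 ∷ []) (c>0 ∷ d>0 ∷ []) leftWins-eq rightWins-eq n)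
    (cong₂ outcomeOf l≡ r≡)

  rightWins-false : ∀ {n} → n < c ⊎ c + a ≤ n → n < d ⊎ d + a ≤ n → rightWins n ≡ false
  rightWins-false out-c out-d = dec-false (rightWindow? _) (outsideRightWindow out-c out-d)

  rightWins-true : ∀ {n} → RightWindow n → rightWins n ≡ true
  rightWins-true = dec-true (rightWindow? _)

mainTheorem12 : (a b c d : ℕ) → 0 < a → 0 < b → 0 < c → 0 < d →
    2 * a ≤ b → b < c → c + b < d →
    ((n : ℕ) → n < a → outcome (a ∷ b ∷ []) (c ∷ d ∷ []) n ≡ 𝓟)
    × ((n : ℕ) → a ≤ n → n < c → outcome (a ∷ b ∷ []) (c ∷ d ∷ []) n ≡ 𝓛)
    × ((n : ℕ) → c ≤ n → n < c + a → outcome (a ∷ b ∷ []) (c ∷ d ∷ []) n ≡ 𝓝)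
    × ((n : ℕ) → c + a ≤ n → n < d → outcome (a ∷ b ∷ []) (c ∷ d ∷ []) n ≡ 𝓛)
    × ((n : ℕ) → d ≤ n → n < d + a → outcome (a ∷ b ∷ []) (c ∷ d ∷ []) n ≡ 𝓝)
    × ((n : ℕ) → d + a ≤ n → outcome (a ∷ b ∷ []) (c ∷ d ∷ []) n ≡ 𝓛)
mainTheorem12 a b c d a>0 b>0 c>0 d>0 2a≤b b<c c+b<d =
    (λ n n<a → outcome≡ (dec-false (a ≤? n) (<⇒≱ n<a))
      (rightWins-false (inj₁ (<-trans n<a a<c)) (inj₁ (<-trans n<a a<d))))
  , (λ n a≤n n<c → outcome≡ (dec-true (a ≤? n) a≤n)
      (rightWins-false (inj₁ n<c) (inj₁ (<-trans n<c c<d))))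
  , (λ n c≤n n<c+a → outcome≡ (dec-true (a ≤? n) (≤-trans (<⇒≤ a<c) c≤n))
      (rightWins-true (here (c≤n , n<c+a))))
  , (λ n c+a≤n n<d → outcome≡ (dec-true (a ≤? n) (≤-trans (m≤n+m a c) c+a≤n))
      (rightWins-false (inj₂ c+a≤n) (inj₁ n<d)))
  , (λ n d≤n n<d+a → outcome≡ (dec-true (a ≤? n) (≤-trans (<⇒≤ a<d) d≤n))
      (rightWins-true (there (here (d≤n , n<d+a)))))
  , (λ n d+a≤n → outcome≡ (dec-true (a ≤? n) (≤-trans (m≤n+m a d) d+a≤n))
      (rightWins-false (inj₂ (≤-trans (+-monoˡ-≤ a (<⇒≤ c<d)) d+a≤n)) (inj₂ d+a≤n)))
  where open Game a b c d a>0 b>0 c>0 d>0 2a≤b b<c c+b<d
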